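{- Let $\Psi\subset\Delta^+_\ell$ be a root ideal, $\gamma\in\mathbb{Z}^\ell$, $w\in H_\ell$, and let $\alpha=(i,j)\in\Psi$ be a removable root, i.e. $\Psi\setminus\{\alpha\}$ is a root ideal. Then \[ H(\Psi;\gamma;w)=H(\Psi\setminus\alpha;\gamma;w)+q\,H(\Psi;\gamma+\epsilon_i-\epsilon_j;w). \]
   Context: $\epsilon_i$ are the standard basis vectors of $\mathbb{Z}^\ell$. A root ideal is an upper order ideal of $\Delta^+_\ell=\{(i,j):1\le i<j\le\ell\}$ with $(a,b)\le(c,d)$ iff $a\ge c,b\le d$. $\pi_i(f)=\frac{x_if-x_{i+1}s_i(f)}{x_i-x_{i+1}}$; $H_\ell$ the 0-Hecke monoid on $\bar s_1,\dots,\bar s_{\ell-1}$ ($\bar s_i^2=\bar s_i$, commutation and braid relations); $\pi_w$ the composite along any expression. Key polynomials $\kappa_\alpha=\pi_{\mathsf p(\alpha)}\mathbf x^{\alpha^+}$ ($H_\ell$ acts on $\mathbb{Z}^\ell$ by $\bar s_i\alpha=s_i\alpha$ if $\alpha_i\ge\alpha_{i+1}$, else $\alpha$; $\alpha^+$ decreasing rearrangement; $\mathsf p(\alpha)$ shortest with $\mathsf p(\alpha)\alpha^+=\alpha$) form a basis of $\mathbb{Z}[x_1^{\pm1},\dots,x_\ell^{\pm1}]$; $\mathrm{poly}$ is linear with $\mathrm{poly}(\kappa_\alpha)=\kappa_\alpha$ for $\alpha\in\mathbb{Z}_{\ge0}^\ell$, $0$ otherwise, extended coefficientwise to power series in $q$.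 $H(\Psi;\gamma;w)=\pi_w\mathrm{poly}\big(\prod_{(a,b)\in\Psi}(1-qx_a/x_b)^{ -1}\mathbf x^\gamma\big)$. -}

module Defs where

open import Data.Nat as ℕ using (ℕ; zero; suc)
open import Data.Integer as ℤ using (ℤ; +_; -[1+_])
open import Data.Fin as Fin using (Fin; inject₁)
open import Data.Bool using (Bool; true; false; if_then_else_; _∧_; not)
open import Data.Product using (_×_; _,_)
open import Data.List as List using (List; []; _∷_; _++_; upTo; allFin; foldr; concatMap; length)
open import Data.Vec as Vec using (Vec; lookup; tabulate; zipWith; _[_]≔_; toList)
open import Data.Vec.Properties using (≡-dec)
open import Data.List.Relation.Binary.Permutation.Propositional using (_↭_)
open import Relation.Nullary using (¬_; does)
open import Relation.Binary.PropositionalEquality using (_≡_)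

Exp : ℕ → Set
Exp ℓ = Vec ℤ ℓ

ε : ∀ {ℓ} → Fin ℓ → Exp ℓ
ε i = tabulate (λ k → if does (k Fin.≟ i) then + 1 else + 0)

_+ᵉ_ : ∀ {ℓ} → Exp ℓ → Exp ℓ → Exp ℓ
_+ᵉ_ = zipWith ℤ._+_

_-ᵉ_ : ∀ {ℓ} → Exp ℓ → Exp ℓ → Exp ℓ
_-ᵉ_ = zipWith ℤ._-_

-- Laurent polynomials ℤ[x₁^{±1},…,x_ℓ^{±1}], as finite lists of
-- (coefficient , exponent) terms, compared via their coefficient function.

LP : ℕ → Set
LP ℓ = List (ℤ × Exp ℓ)

coeff : ∀ {ℓ} → LP ℓ → Exp ℓ → ℤ
coeff [] e = + 0
coeff ((c , e′) ∷ f) e = (if does (≡-dec ℤ._≟_ e′ e) then c else + 0) ℤ.+ coeff f e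

infix 4 _≈_
_≈_ : ∀ {ℓ} → LP ℓ → LP ℓ → Set
f ≈ g = ∀ e → coeff f e ≡ coeff g e

0ᴾ : ∀ {ℓ} → LP ℓ
0ᴾ = []

mono : ∀ {ℓ} → Exp ℓ → LP ℓ
mono e = (+ 1 , e) ∷ []

_+ᴾ_ : ∀ {ℓ} → LP ℓ → LP ℓ → LP ℓ
_+ᴾ_ = _++_

scale : ∀ {ℓ} → ℤ → LP ℓ → LP ℓ
scale c = List.map (λ { (d , e) → (c ℤ.* d , e) })

_*ᴾ_ : ∀ {ℓ} → LP ℓ → LP ℓ → LP ℓ
f *ᴾ g = concatMap (λ { (c , e) → List.map (λ { (d , e′) → (c ℤ.* d , e +ᵉ e′) }) g }) f

-- Demazure operator π_i (ℓ = suc n, i : Fin n acts on positions i, i+1).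
-- π_i(f) = (x_i f - x_{i+1} s_i f)/(x_i - x_{i+1}); on a monomial with
-- exponents a at i and b at i+1 the exact quotient is
--   a ≥ b     :  Σ_{k=0}^{a-b}   x_i^{a-k} x_{i+1}^{b+k}
--   a = b - 1 :  0
--   a ≤ b - 2 : -Σ_{k=1}^{b-a-1} x_i^{a+k} x_{i+1}^{b-k}
-- (other exponents unchanged).

setPair : ∀ {n} → Fin n → Exp (suc n) → ℤ → ℤ → Exp (suc n)
setPair i β u v = (β [ inject₁ i ]≔ u) [ Fin.suc i ]≔ v

πmono : ∀ {n} → Fin n → ℤ × Exp (suc n) → LP (suc n)
πmono i (c , β) with lookup β (inject₁ i) | lookup β (Fin.suc i)
... | a | b with a ℤ.- b
...   | + m = List.map (λ k → (c , setPair i β (a ℤ.- + k) (b ℤ.+ + k))) (upTo (suc m))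
...   | -[1+ zero ] = []
...   | -[1+ suc m ] = List.map (λ k → (ℤ.- c , setPair i β (a ℤ.+ + k) (b ℤ.- + k))) (List.map suc (upTo (suc m)))

π : ∀ {n} → Fin n → LP (suc n) → LP (suc n)
π i = concatMap (πmono i)

-- Elements of the 0-Hecke monoid H_ℓ given by expressions (words)
-- s̄_{i₁} s̄_{i₂} ⋯ s̄_{i_k}; π_w = π_{i₁} ∘ ⋯ ∘ π_{i_k}.
Word : ℕ → Set
Word n = List (Fin n)

πw : ∀ {n} → Word n → LP (suc n) → LP (suc n)
πw [] f = f
πw (i ∷ u) f = π i (πw u f)

sbar : ∀ {n} → Fin n → Exp (suc n) → Exp (suc n)
sbar i α with lookup α (Fin.suc i) ℤ.≤? lookup α (inject₁ i)
... | Relation.Nullary.yes _ = setPair i α (lookup α (Fin.suc i)) (lookup α (inject₁ i))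
... | Relation.Nullary.no _ = α

act : ∀ {n} → Word n → Exp (suc n) → Exp (suc n)
act [] α = α
act (i ∷ u) α = sbar i (act u α)

Decreasing : ∀ {n} → Exp (suc n) → Set
Decreasing {n} β = ∀ (i : Fin n) → lookup β (Fin.suc i) ℤ.≤ lookup β (inject₁ i)

IsDecRearr : ∀ {n} → Exp (suc n) → Exp (suc n) → Set
IsDecRearr α β = Decreasing β × (toList β ↭ toList α)

Shortest : ∀ {n} → Word n → Exp (suc n) → Exp (suc n) → Set
Shortest u β α = act u β ≡ α × (∀ v → act v β ≡ α → length u ℕ.≤ length v)

NonNeg : ∀ {ℓ} → Exp ℓ → Set
NonNeg α = ∀ k → + 0 ℤ.≤ lookup α k

-- κ_α = π_{p(α)} x^{α⁺}, written with α⁺ = β and p(α) = u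
-- poly : the linear map with poly(κ_α) = κ_α (α ≥ 0), 0 otherwise.
-- Since the κ_α form a basis, such a map exists and is unique (up to ≈);
-- we characterise it by these properties.
record IsPoly {n} (P : LP (suc n) → LP (suc n)) : Set where
  field
    resp  : ∀ {f g} → f ≈ g → P f ≈ P g
    additive : ∀ f g → P (f +ᴾ g) ≈ P f +ᴾ P g
    homogeneous : ∀ c f → P (scale c f) ≈ scale c (P f)
    key-pos : ∀ α β u → IsDecRearr α β → Shortest u β α → NonNeg α →
              P (πw u (mono β)) ≈ πw u (mono β)
    key-neg : ∀ α β u → IsDecRearr α β → Shortest u β α → ¬ NonNeg α →
              P (πw u (mono β)) ≈ 0ᴾ

-- Formal power series in q with Laurent polynomial coefficients

Series : ℕ → Set
Series ℓ = ℕ → LP ℓ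

sumTo : ∀ {ℓ} → (ℕ → LP ℓ) → ℕ → LP ℓ
sumTo f zero = f zero
sumTo f (suc m) = sumTo f m +ᴾ f (suc m)

_·ˢ_ : ∀ {ℓ} → Series ℓ → Series ℓ → Series ℓ
(F ·ˢ G) m = sumTo (λ k → F k *ᴾ G (m ℕ.∸ k)) m

_+ˢ_ : ∀ {ℓ} → Series ℓ → Series ℓ → Series ℓ
(F +ˢ G) m = F m +ᴾ G m

qshift : ∀ {ℓ} → Series ℓ → Series ℓ
qshift F zero = 0ᴾ
qshift F (suc m) = F m

1ˢ : ∀ {ℓ} → Series ℓ
1ˢ zero = mono (Vec.replicate _ (+ 0))
1ˢ (suc m) = 0ᴾ

-- (1 - q x_a / x_b)^{-1} = Σ_m q^m x^{m(ε_a - ε_b)}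
geom : ∀ {ℓ} → Fin ℓ → Fin ℓ → Series ℓ
geom a b m = mono (Vec.map (λ z → + m ℤ.* z) (ε a -ᵉ ε b))

RootSet : ℕ → Set
RootSet ℓ = Fin ℓ → Fin ℓ → Bool

IsRootIdeal : ∀ {ℓ} → RootSet ℓ → Set
IsRootIdeal Ψ =
  (∀ a b → Ψ a b ≡ true → a Fin.< b) ×
  (∀ a b c d → Ψ a b ≡ true → c Fin.≤ a → b Fin.≤ d → Ψ c d ≡ true)

remove : ∀ {ℓ} → RootSet ℓ → Fin ℓ → Fin ℓ → RootSet ℓ
remove Ψ i j a b = Ψ a b ∧ not (does (a Fin.≟ i) ∧ does (b Fin.≟ j))

pairs : ∀ ℓ → List (Fin ℓ × Fin ℓ)
pairs ℓ = concatMap (λ a → List.map (a ,_) (allFin ℓ)) (allFin ℓ)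

prodΨ : ∀ {ℓ} → RootSet ℓ → Series ℓ
prodΨ {ℓ} Ψ = foldr (λ { (a , b) acc → if Ψ a b then geom a b ·ˢ acc else acc }) 1ˢ (pairs ℓ)

H : ∀ {n} → (P : LP (suc n) → LP (suc n)) → RootSet (suc n) → Exp (suc n) → Word n → Series (suc n)
H P Ψ γ w m = πw w (P (prodΨ Ψ m *ᴾ mono γ))

module Submission where

-- The identity already holds before poly and π_w are applied.  Writing
-- δ = ε_i - ε_j, the factor of α is the geometric series G = (1 - q x^δ)^{-1},
-- which satisfies G = 1 + q x^δ G.  Hence S = Π_Ψ satisfies the recurrence
--   S = Π_{Ψ∖α} + q x^δ S,
-- and this recurrence is preserved by multiplying S and Π_{Ψ∖α} with any other
-- geometric factor; running through the list of all pairs, in which α occurs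
-- exactly once, gives it for the full products (no commutation of series is needed).
-- Multiplying by x^γ turns q x^δ S into q Π_Ψ x^{γ+δ}, and the operator
-- f ↦ π_w (poly f) is linear and respects equality of coefficients, which gives
-- the theorem degree by degree in q.

open import Defs
open import Data.Nat using (ℕ; suc)
open import Data.Fin using (Fin)
open import Data.Bool using (true)
open import Relation.Binary.PropositionalEquality using (_≡_)

open import Data.Nat as ℕ using (zero; _∸_; _≤_; z≤n; s≤s)
import Data.Nat.Properties as ℕP
open import Data.Integer as ℤ using (ℤ; +_)
import Data.Integer.Properties as ℤP
open import Data.Integer.Tactic.RingSolver using (solve-∀)
open import Data.Bool using (Bool; false; if_then_else_)
import Data.Bool.Properties as BoolP
open import Data.Product using (_×_; _,_)
open import Data.List as List using (List; []; _∷_; _++_; foldr; concatMap; length; allFin; cartesianProduct)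
import Data.List.Properties as ListP
import Data.List.Relation.Unary.All as All
open import Data.List.Relation.Unary.All using (All)
open import Data.List.Relation.Unary.AllPairs using (_∷_)
open import Data.List.Relation.Unary.Any using (here; there)
open import Data.List.Relation.Unary.Unique.Propositional using (Unique)
open import Data.List.Relation.Unary.Unique.Propositional.Properties using (cartesianProduct⁺; allFin⁺)
open import Data.List.Membership.Propositional using (_∈_)
open import Data.List.Membership.Propositional.Properties using (∈-cartesianProduct⁺; ∈-allFin)
import Data.Vec as Vec
open import Data.Vec.Properties using (≡-dec; zipWith-assoc; zipWith-comm)
import Data.Fin as Fin
open import Function.Bundles using (mk⇔)
open import Relation.Nullary using (yes; no; does)
open import Relation.Nullary.Decidable using (does-⇔; dec-false)
open import Relation.Binary.Bundles using (Setoid)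
open import Relation.Binary.PropositionalEquality using (refl; sym; trans; cong; cong₂; subst; subst₂; _≢_)
import Relation.Binary.Reasoning.Setoid as SetoidReasoning
open import Data.Empty using (⊥-elim)

-- Coefficientwise equality.  'f ≈ g' unfolds to a function type from which
-- f and g cannot be inferred; wrapping it in a record keeps them inferable.
infix 4 _≋_
record _≋_ {ℓ} (f g : LP ℓ) : Set where
  constructor ⟨_⟩
  field coeffwise : f ≈ g
open _≋_

≋-refl : ∀ {ℓ} {f : LP ℓ} → f ≋ f
≋-refl = ⟨ (λ _ → refl) ⟩

≋-sym : ∀ {ℓ} {f g : LP ℓ} → f ≋ g → g ≋ f
≋-sym ⟨ p ⟩ = ⟨ (λ e → sym (p e)) ⟩

≋-trans : ∀ {ℓ} {f g h : LP ℓ} → f ≋ g → g ≋ h → f ≋ h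
≋-trans ⟨ p ⟩ ⟨ q ⟩ = ⟨ (λ e → trans (p e) (q e)) ⟩

≡⇒≋ : ∀ {ℓ} {f g : LP ℓ} → f ≡ g → f ≋ g
≡⇒≋ refl = ≋-refl

LP-setoid : ℕ → Setoid _ _
LP-setoid ℓ = record
  { Carrier = LP ℓ
  ; _≈_ = _≋_
  ; isEquivalence = record { refl = ≋-refl ; sym = ≋-sym ; trans = ≋-trans }
  }

module ≋-Reasoning {ℓ : ℕ} = SetoidReasoning (LP-setoid ℓ)

coeff-++ : ∀ {ℓ} (f g : LP ℓ) e → coeff (f ++ g) e ≡ coeff f e ℤ.+ coeff g e
coeff-++ [] g e = sym (ℤP.+-identityˡ _)
coeff-++ ((c , e′) ∷ f) g e =
  trans (cong (λ x → head ℤ.+ x) (coeff-++ f g e)) (sym (ℤP.+-assoc head (coeff f e) (coeff g e)))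
  where
  head : ℤ
  head = if does (≡-dec ℤ._≟_ e′ e) then c else + 0

++-cong : ∀ {ℓ} {f f′ g g′ : LP ℓ} → f ≋ f′ → g ≋ g′ → f ++ g ≋ f′ ++ g′
++-cong {f = f} {f′} {g} {g′} ⟨ p ⟩ ⟨ q ⟩ =
  ⟨ (λ e → trans (coeff-++ f g e) (trans (cong₂ ℤ._+_ (p e) (q e)) (sym (coeff-++ f′ g′ e)))) ⟩

++-comm-≋ : ∀ {ℓ} (f g : LP ℓ) → f ++ g ≋ g ++ f
++-comm-≋ f g = ⟨ (λ e → trans (coeff-++ f g e) (trans (ℤP.+-comm (coeff f e) (coeff g e)) (sym (coeff-++ g f e)))) ⟩

++-interchange : ∀ {ℓ} (a b c d : LP ℓ) → (a ++ b) ++ (c ++ d) ≋ (a ++ c) ++ (b ++ d)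
++-interchange a b c d = begin
  (a ++ b) ++ (c ++ d)   ≡⟨ ListP.++-assoc a b (c ++ d) ⟩
  a ++ (b ++ (c ++ d))   ≡⟨ cong (a ++_) (sym (ListP.++-assoc b c d)) ⟩
  a ++ ((b ++ c) ++ d)   ≈⟨ ++-cong (≋-refl {f = a}) (++-cong (++-comm-≋ b c) (≋-refl {f = d})) ⟩
  a ++ ((c ++ b) ++ d)   ≡⟨ cong (a ++_) (ListP.++-assoc c b d) ⟩
  a ++ (c ++ (b ++ d))   ≡⟨ sym (ListP.++-assoc a c (b ++ d)) ⟩
  (a ++ c) ++ (b ++ d)   ∎
  where open ≋-Reasoning

*-if : ∀ (c d : ℤ) (b : Bool) → c ℤ.* (if b then d else + 0) ≡ (if b then c ℤ.* d else + 0)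
*-if c d true = refl
*-if c d false = ℤP.*-zeroʳ c

coeff-scale : ∀ {ℓ} c (f : LP ℓ) e → coeff (scale c f) e ≡ c ℤ.* coeff f e
coeff-scale c [] e = sym (ℤP.*-zeroʳ c)
coeff-scale c ((d , e′) ∷ f) e =
  trans (cong₂ ℤ._+_ (sym (*-if c d (does (≡-dec ℤ._≟_ e′ e)))) (coeff-scale c f e))
        (sym (ℤP.*-distribˡ-+ c _ (coeff f e)))

+ᵉ-assoc : ∀ {ℓ} (a b c : Exp ℓ) → (a +ᵉ b) +ᵉ c ≡ a +ᵉ (b +ᵉ c)
+ᵉ-assoc = zipWith-assoc ℤP.+-assoc

+ᵉ-comm : ∀ {ℓ} (a b : Exp ℓ) → a +ᵉ b ≡ b +ᵉ a
+ᵉ-comm = zipWith-comm ℤP.+-comm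

add-sub-cancel : ∀ {ℓ} (a d : Exp ℓ) → (a +ᵉ d) -ᵉ d ≡ a
add-sub-cancel Vec.[] Vec.[] = refl
add-sub-cancel (x Vec.∷ a) (y Vec.∷ d) = cong₂ Vec._∷_ (cancel x y) (add-sub-cancel a d)
  where
  cancel : ∀ (x y : ℤ) → (x ℤ.+ y) ℤ.- y ≡ x
  cancel = solve-∀

sub-add-cancel : ∀ {ℓ} (a d : Exp ℓ) → (a -ᵉ d) +ᵉ d ≡ a
sub-add-cancel Vec.[] Vec.[] = refl
sub-add-cancel (x Vec.∷ a) (y Vec.∷ d) = cong₂ Vec._∷_ (cancel x y) (sub-add-cancel a d)
  where
  cancel : ∀ (x y : ℤ) → (x ℤ.- y) ℤ.+ y ≡ x
  cancel = solve-∀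

sub-add-rotate : ∀ {ℓ} (a b g : Exp ℓ) → (a -ᵉ b) +ᵉ g ≡ (g +ᵉ a) -ᵉ b
sub-add-rotate Vec.[] Vec.[] Vec.[] = refl
sub-add-rotate (x Vec.∷ a) (y Vec.∷ b) (z Vec.∷ g) = cong₂ Vec._∷_ (rotate x y z) (sub-add-rotate a b g)
  where
  rotate : ∀ (x y z : ℤ) → (x ℤ.- y) ℤ.+ z ≡ (z ℤ.+ x) ℤ.- y
  rotate = solve-∀

-- The multiple k·v, which is the exponent of the q^k term of (1 - q x^v)^{-1}.
_·ᵉ_ : ∀ {ℓ} → ℕ → Exp ℓ → Exp ℓ
k ·ᵉ v = Vec.map (λ z → + k ℤ.* z) v

+ᵉ-0·ᵉ : ∀ {ℓ} (a v : Exp ℓ) → a +ᵉ (0 ·ᵉ v) ≡ a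
+ᵉ-0·ᵉ Vec.[] Vec.[] = refl
+ᵉ-0·ᵉ (x Vec.∷ a) (y Vec.∷ v) = cong₂ Vec._∷_ (ℤP.+-identityʳ x) (+ᵉ-0·ᵉ a v)

suc-·ᵉ : ∀ {ℓ} k (v : Exp ℓ) → suc k ·ᵉ v ≡ (k ·ᵉ v) +ᵉ v
suc-·ᵉ k Vec.[] = refl
suc-·ᵉ k (y Vec.∷ v) = cong₂ Vec._∷_ (trans (cong (ℤ._* y) (ℤP.pos-+ 1 k)) (succ (+ k) y)) (suc-·ᵉ k v)
  where
  succ : ∀ (x y : ℤ) → (+ 1 ℤ.+ x) ℤ.* y ≡ x ℤ.* y ℤ.+ y
  succ = solve-∀

sh : ∀ {ℓ} → Exp ℓ → LP ℓ → LP ℓ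
sh d = List.map (λ { (c , e) → (c , e +ᵉ d) })

coeff-sh : ∀ {ℓ} d (f : LP ℓ) e → coeff (sh d f) e ≡ coeff f (e -ᵉ d)
coeff-sh d [] e = refl
coeff-sh d ((c , e′) ∷ f) e =
  cong₂ ℤ._+_ (cong (λ b → if b then c else + 0) (does-⇔ (mk⇔ shiftBack shiftForth) (≡-dec ℤ._≟_ (e′ +ᵉ d) e) (≡-dec ℤ._≟_ e′ (e -ᵉ d)))) (coeff-sh d f e)
  where
  shiftBack : e′ +ᵉ d ≡ e → e′ ≡ e -ᵉ d
  shiftBack p = trans (sym (add-sub-cancel e′ d)) (cong (_-ᵉ d) p)
  shiftForth : e′ ≡ e -ᵉ d → e′ +ᵉ d ≡ e
  shiftForth p = trans (cong (_+ᵉ d) p) (sub-add-cancel e d)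

sh-cong : ∀ {ℓ} d {f g : LP ℓ} → f ≋ g → sh d f ≋ sh d g
sh-cong d {f} {g} ⟨ p ⟩ = ⟨ (λ e → trans (coeff-sh d f e) (trans (p _) (sym (coeff-sh d g e)))) ⟩

sh-++ : ∀ {ℓ} d (f g : LP ℓ) → sh d (f ++ g) ≡ sh d f ++ sh d g
sh-++ d = ListP.map-++ _

sh-sh : ∀ {ℓ} a b (f : LP ℓ) → sh a (sh b f) ≡ sh (b +ᵉ a) f
sh-sh a b [] = refl
sh-sh a b ((c , e) ∷ f) = cong₂ _∷_ (cong (c ,_) (+ᵉ-assoc e b a)) (sh-sh a b f)

sh-comm : ∀ {ℓ} a b (f : LP ℓ) → sh a (sh b f) ≡ sh b (sh a f)
sh-comm a b f = trans (sh-sh a b f) (trans (cong (λ d → sh d f) (+ᵉ-comm b a)) (sym (sh-sh b a f)))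

sh-0·ᵉ : ∀ {ℓ} (v : Exp ℓ) (f : LP ℓ) → sh (0 ·ᵉ v) f ≡ f
sh-0·ᵉ v [] = refl
sh-0·ᵉ v ((c , e) ∷ f) = cong₂ _∷_ (cong (c ,_) (+ᵉ-0·ᵉ e v)) (sh-0·ᵉ v f)

mono-*ᴾ : ∀ {ℓ} d (f : LP ℓ) → mono d *ᴾ f ≡ sh d f
mono-*ᴾ d [] = refl
mono-*ᴾ d ((c , e) ∷ f) = cong₂ _∷_ (cong₂ _,_ (ℤP.*-identityˡ c) (+ᵉ-comm d e)) (mono-*ᴾ d f)

*ᴾ-mono : ∀ {ℓ} d (f : LP ℓ) → f *ᴾ mono d ≡ sh d f
*ᴾ-mono d [] = refl
*ᴾ-mono d ((c , e) ∷ f) = cong₂ _∷_ (cong (_, e +ᵉ d) (ℤP.*-identityʳ c)) (*ᴾ-mono d f)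

sumTo-cong : ∀ {ℓ} m (f g : ℕ → LP ℓ) → (∀ k → k ≤ m → f k ≋ g k) → sumTo f m ≋ sumTo g m
sumTo-cong zero f g f≋g = f≋g 0 z≤n
sumTo-cong (suc m) f g f≋g =
  ++-cong (sumTo-cong m f g (λ k k≤m → f≋g k (ℕP.m≤n⇒m≤1+n k≤m))) (f≋g (suc m) ℕP.≤-refl)

sumTo-++ : ∀ {ℓ} m (f g : ℕ → LP ℓ) → sumTo (λ k → f k ++ g k) m ≋ sumTo f m ++ sumTo g m
sumTo-++ zero f g = ≋-refl
sumTo-++ (suc m) f g =
  ≋-trans (++-cong (sumTo-++ m f g) ≋-refl) (++-interchange (sumTo f m) (sumTo g m) (f (suc m)) (g (suc m)))

sumTo-peel : ∀ {ℓ} m (f : ℕ → LP ℓ) → sumTo f (suc m) ≋ f 0 ++ sumTo (λ k → f (suc k)) m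
sumTo-peel zero f = ≋-refl
sumTo-peel (suc m) f =
  ≋-trans (++-cong (sumTo-peel m f) ≋-refl)
          (≡⇒≋ (ListP.++-assoc (f 0) (sumTo (λ k → f (suc k)) m) (f (suc (suc m)))))

sh-sumTo : ∀ {ℓ} d m (f : ℕ → LP ℓ) → sh d (sumTo f m) ≡ sumTo (λ k → sh d (f k)) m
sh-sumTo d zero f = refl
sh-sumTo d (suc m) f = trans (sh-++ d (sumTo f m) (f (suc m))) (cong (_++ sh d (f (suc m))) (sh-sumTo d m f))

qx : ∀ {ℓ} → Exp ℓ → Series ℓ → Series ℓ
qx d X = qshift (λ k → sh d (X k))

qx-cong : ∀ {ℓ} d {X Y : Series ℓ} → (∀ k → X k ≋ Y k) → ∀ m → qx d X m ≋ qx d Y m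
qx-cong d X≋Y zero = ≋-refl
qx-cong d X≋Y (suc m) = sh-cong d (X≋Y m)

-- Multiplication of a series by Σ_k q^k x^{k·v} = (1 - q x^v)^{-1}.
geomMul : ∀ {ℓ} → Exp ℓ → Series ℓ → Series ℓ
geomMul v X m = sumTo (λ k → sh (k ·ᵉ v) (X (m ∸ k))) m

geom-·ˢ : ∀ {ℓ} (a b : Fin ℓ) (X : Series ℓ) m → (geom a b ·ˢ X) m ≋ geomMul (ε a -ᵉ ε b) X m
geom-·ˢ a b X m = sumTo-cong m _ _ (λ k _ → ≡⇒≋ (mono-*ᴾ _ (X (m ∸ k))))

geomMul-cong : ∀ {ℓ} v {X Y : Series ℓ} → (∀ k → X k ≋ Y k) → ∀ m → geomMul v X m ≋ geomMul v Y m
geomMul-cong v X≋Y m = sumTo-cong m _ _ (λ k _ → sh-cong (k ·ᵉ v) (X≋Y (m ∸ k)))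

geomMul-+ˢ : ∀ {ℓ} v (X Y : Series ℓ) m → geomMul v (X +ˢ Y) m ≋ geomMul v X m ++ geomMul v Y m
geomMul-+ˢ v X Y m =
  ≋-trans (sumTo-cong m _ _ (λ k _ → ≡⇒≋ (sh-++ (k ·ᵉ v) (X (m ∸ k)) (Y (m ∸ k)))))
          (sumTo-++ m (λ k → sh (k ·ᵉ v) (X (m ∸ k))) (λ k → sh (k ·ᵉ v) (Y (m ∸ k))))

geomMul-qx : ∀ {ℓ} v d (X : Series ℓ) m → geomMul v (qx d X) m ≋ qx d (geomMul v X) m
geomMul-qx v d X zero = ≋-refl
geomMul-qx v d X (suc m) = begin
  sumTo (λ k → sh (k ·ᵉ v) (qx d X (suc m ∸ k))) m ++ sh (suc m ·ᵉ v) (qx d X (m ∸ m))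
    ≈⟨ ++-cong (sumTo-cong m _ _ inner) top ⟩
  sumTo (λ k → sh d (sh (k ·ᵉ v) (X (m ∸ k)))) m ++ []
    ≡⟨ ListP.++-identityʳ _ ⟩
  sumTo (λ k → sh d (sh (k ·ᵉ v) (X (m ∸ k)))) m
    ≡⟨ sym (sh-sumTo d m (λ k → sh (k ·ᵉ v) (X (m ∸ k)))) ⟩
  qx d (geomMul v X) (suc m) ∎
  where
  open ≋-Reasoning
  -- the top term carries q^0 of qx d X, which vanishes
  top : sh (suc m ·ᵉ v) (qx d X (m ∸ m)) ≋ []
  top rewrite ℕP.n∸n≡0 m = ≋-refl
  inner : ∀ k → k ≤ m → sh (k ·ᵉ v) (qx d X (suc m ∸ k)) ≋ sh d (sh (k ·ᵉ v) (X (m ∸ k)))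
  inner k k≤m rewrite ℕP.+-∸-assoc 1 k≤m = ≡⇒≋ (sh-comm (k ·ᵉ v) d (X (m ∸ k)))

-- S satisfies S = R + q x^δ S degree by degree, i.e. S = R·(1 - q x^δ)^{-1}.
Recurrence : ∀ {ℓ} → Exp ℓ → Series ℓ → Series ℓ → Set
Recurrence δ S R = ∀ m → S m ≋ R m ++ qx δ S m

geomMul-recurrence : ∀ {ℓ} v (X : Series ℓ) → Recurrence v (geomMul v X) X
geomMul-recurrence v X zero = ≋-trans (≡⇒≋ (sh-0·ᵉ v (X 0))) (≡⇒≋ (sym (ListP.++-identityʳ (X 0))))
geomMul-recurrence v X (suc m) = begin
  geomMul v X (suc m)
    ≈⟨ sumTo-peel m (λ k → sh (k ·ᵉ v) (X (suc m ∸ k))) ⟩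
  sh (0 ·ᵉ v) (X (suc m)) ++ sumTo (λ k → sh (suc k ·ᵉ v) (X (m ∸ k))) m
    ≈⟨ ++-cong (≡⇒≋ (sh-0·ᵉ v (X (suc m)))) (sumTo-cong m _ _ shiftOnce) ⟩
  X (suc m) ++ sumTo (λ k → sh v (sh (k ·ᵉ v) (X (m ∸ k)))) m
    ≡⟨ cong (X (suc m) ++_) (sym (sh-sumTo v m (λ k → sh (k ·ᵉ v) (X (m ∸ k))))) ⟩
  X (suc m) ++ qx v (geomMul v X) (suc m) ∎
  where
  open ≋-Reasoning
  shiftOnce : ∀ k → k ≤ m → sh (suc k ·ᵉ v) (X (m ∸ k)) ≋ sh v (sh (k ·ᵉ v) (X (m ∸ k)))
  shiftOnce k _ = ≡⇒≋ (trans (cong (λ d → sh d (X (m ∸ k))) (suc-·ᵉ k v)) (sym (sh-sh v (k ·ᵉ v) (X (m ∸ k)))))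

geom-recurrence : ∀ {ℓ} (a b : Fin ℓ) (X : Series ℓ) → Recurrence (ε a -ᵉ ε b) (geom a b ·ˢ X) X
geom-recurrence a b X m = begin
  (geom a b ·ˢ X) m                 ≈⟨ geom-·ˢ a b X m ⟩
  geomMul v X m                     ≈⟨ geomMul-recurrence v X m ⟩
  X m ++ qx v (geomMul v X) m       ≈⟨ ++-cong ≋-refl (qx-cong v (λ k → ≋-sym (geom-·ˢ a b X k)) m) ⟩
  X m ++ qx v (geom a b ·ˢ X) m     ∎
  where
  open ≋-Reasoning
  v : Exp _
  v = ε a -ᵉ ε b

geom-preserves-recurrence : ∀ {ℓ} δ (a b : Fin ℓ) {S R : Series ℓ} → Recurrence δ S R →
                            Recurrence δ (geom a b ·ˢ S) (geom a b ·ˢ R)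
geom-preserves-recurrence δ a b {S} {R} rec m = begin
  (geom a b ·ˢ S) m                               ≈⟨ geom-·ˢ a b S m ⟩
  geomMul v S m                                   ≈⟨ geomMul-cong v rec m ⟩
  geomMul v (R +ˢ qx δ S) m                       ≈⟨ geomMul-+ˢ v R (qx δ S) m ⟩
  geomMul v R m ++ geomMul v (qx δ S) m           ≈⟨ ++-cong (≋-sym (geom-·ˢ a b R m)) (geomMul-qx v δ S m) ⟩
  (geom a b ·ˢ R) m ++ qx δ (geomMul v S) m       ≈⟨ ++-cong ≋-refl (qx-cong δ (λ k → ≋-sym (geom-·ˢ a b S k)) m) ⟩
  (geom a b ·ˢ R) m ++ qx δ (geom a b ·ˢ S) m     ∎
  where
  open ≋-Reasoning
  v : Exp _
  v = ε a -ᵉ ε b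

factor : ∀ {ℓ} → RootSet ℓ → Fin ℓ × Fin ℓ → Series ℓ → Series ℓ
factor Ψ (a , b) S = if Ψ a b then geom a b ·ˢ S else S

prodOver : ∀ {ℓ} → RootSet ℓ → List (Fin ℓ × Fin ℓ) → Series ℓ
prodOver Ψ = foldr (factor Ψ) 1ˢ

-- prodΨ runs over all pairs, a duplicate-free list.
prodΨ-as-prodOver : ∀ {ℓ} (Ψ : RootSet ℓ) → prodΨ Ψ ≡ prodOver Ψ (cartesianProduct (allFin ℓ) (allFin ℓ))
prodΨ-as-prodOver {ℓ} Ψ =
  trans (ListP.foldr-cong (λ { (a , b) S → refl }) refl (pairs ℓ)) (cong (prodOver Ψ) (pairs-product (allFin ℓ)))
  where
  pairs-product : ∀ xs → concatMap (λ a → List.map (a ,_) (allFin ℓ)) xs ≡ cartesianProduct xs (allFin ℓ)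
  pairs-product [] = refl
  pairs-product (x ∷ xs) = cong (List.map (x ,_) (allFin ℓ) ++_) (pairs-product xs)

remove-other : ∀ {ℓ} (Ψ : RootSet ℓ) i j a b → (i , j) ≢ (a , b) → remove Ψ i j a b ≡ Ψ a b
remove-other Ψ i j a b ne with a Fin.≟ i | b Fin.≟ j
... | yes refl | yes refl = ⊥-elim (ne refl)
... | yes _ | no _ = BoolP.∧-identityʳ (Ψ a b)
... | no _ | _ = BoolP.∧-identityʳ (Ψ a b)

remove-same : ∀ {ℓ} (Ψ : RootSet ℓ) i j → remove Ψ i j i j ≡ false
remove-same Ψ i j with i Fin.≟ i | j Fin.≟ j
... | yes _ | yes _ = BoolP.∧-zeroʳ (Ψ i j)
... | no i≢i | _ = ⊥-elim (i≢i refl)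
... | yes _ | no j≢j = ⊥-elim (j≢j refl)

prodOver-avoiding : ∀ {ℓ} (Ψ : RootSet ℓ) i j {L} → All ((i , j) ≢_) L →
                    prodOver Ψ L ≡ prodOver (remove Ψ i j) L
prodOver-avoiding Ψ i j All.[] = refl
prodOver-avoiding Ψ i j {(a , b) ∷ L} (ne All.∷ avoid) =
  cong₂ (λ t S → if t then geom a b ·ˢ S else S) (sym (remove-other Ψ i j a b ne)) (prodOver-avoiding Ψ i j avoid)

factor-preserves-recurrence : ∀ {ℓ} δ (a b : Fin ℓ) (t : Bool) {S R : Series ℓ} → Recurrence δ S R →
                              Recurrence δ (if t then geom a b ·ˢ S else S) (if t then geom a b ·ˢ R else R)
factor-preserves-recurrence δ a b true rec = geom-preserves-recurrence δ a b rec
factor-preserves-recurrence δ a b false rec = rec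

prodOver-recurrence : ∀ {ℓ} (Ψ : RootSet ℓ) i j → Ψ i j ≡ true → ∀ {L} → Unique L → (i , j) ∈ L →
                      Recurrence (ε i -ᵉ ε j) (prodOver Ψ L) (prodOver (remove Ψ i j) L)
prodOver-recurrence Ψ i j Ψij {(i , j) ∷ L} (fresh ∷ _) (here refl) =
  subst₂ (Recurrence (ε i -ᵉ ε j)) (sym withFactor) (sym withoutFactor) (geom-recurrence i j (prodOver (remove Ψ i j) L))
  where
  withFactor : factor Ψ (i , j) (prodOver Ψ L) ≡ geom i j ·ˢ prodOver (remove Ψ i j) L
  withFactor = trans (cong (λ t → if t then geom i j ·ˢ prodOver Ψ L else prodOver Ψ L) Ψij)
                     (cong (geom i j ·ˢ_) (prodOver-avoiding Ψ i j fresh))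
  withoutFactor : factor (remove Ψ i j) (i , j) (prodOver (remove Ψ i j) L) ≡ prodOver (remove Ψ i j) L
  withoutFactor = cong (λ t → if t then geom i j ·ˢ prodOver (remove Ψ i j) L else prodOver (remove Ψ i j) L)
                       (remove-same Ψ i j)
prodOver-recurrence Ψ i j Ψij {(a , b) ∷ L} (fresh ∷ unique) (there ij∈L) =
  subst (Recurrence (ε i -ᵉ ε j) (factor Ψ (a , b) (prodOver Ψ L)))
        (cong (λ t → if t then geom a b ·ˢ R else R) (sym (remove-other Ψ i j a b ij≢ab)))
        (factor-preserves-recurrence (ε i -ᵉ ε j) a b (Ψ a b) (prodOver-recurrence Ψ i j Ψij unique ij∈L))
  where
  R : Series _
  R = prodOver (remove Ψ i j) L
  ij≢ab : (i , j) ≢ (a , b)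
  ij≢ab eq = All.lookup fresh ij∈L (sym eq)

prodΨ-recurrence : ∀ {ℓ} (Ψ : RootSet ℓ) i j → Ψ i j ≡ true →
                   Recurrence (ε i -ᵉ ε j) (prodΨ Ψ) (prodΨ (remove Ψ i j))
prodΨ-recurrence {ℓ} Ψ i j Ψij =
  subst₂ (Recurrence (ε i -ᵉ ε j)) (sym (prodΨ-as-prodOver Ψ)) (sym (prodΨ-as-prodOver (remove Ψ i j)))
    (prodOver-recurrence Ψ i j Ψij (cartesianProduct⁺ (allFin⁺ ℓ) (allFin⁺ ℓ))
      (∈-cartesianProduct⁺ (∈-allFin i) (∈-allFin j)))

recurrence-*ᴾ-mono : ∀ {ℓ} δ {S R : Series ℓ} → Recurrence δ S R → ∀ γ γ′ → δ +ᵉ γ ≡ γ′ →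
                     ∀ m → S m *ᴾ mono γ ≋ (R m *ᴾ mono γ) ++ qshift (λ k → S k *ᴾ mono γ′) m
recurrence-*ᴾ-mono δ {S} {R} rec γ γ′ δ+γ≡γ′ m = begin
  S m *ᴾ mono γ                  ≡⟨ *ᴾ-mono γ (S m) ⟩
  sh γ (S m)                     ≈⟨ sh-cong γ (rec m) ⟩
  sh γ (R m ++ qx δ S m)         ≡⟨ sh-++ γ (R m) (qx δ S m) ⟩
  sh γ (R m) ++ sh γ (qx δ S m)  ≡⟨ cong₂ _++_ (sym (*ᴾ-mono γ (R m))) (shifted m) ⟩
  (R m *ᴾ mono γ) ++ qshift (λ k → S k *ᴾ mono γ′) m ∎
  where
  open ≋-Reasoning
  shifted : ∀ m → sh γ (qx δ S m) ≡ qshift (λ k → S k *ᴾ mono γ′) m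
  shifted zero = refl
  shifted (suc k) = trans (sh-sh γ δ (S k)) (trans (cong (λ d → sh d (S k)) δ+γ≡γ′) (sym (*ᴾ-mono γ′ (S k))))

-- A map of the form concatMap T with T linear
-- in the coefficient is determined on f by the pairing Σ_{(c,e) ∈ f} c·φ(e),
-- which depends only on the coefficients of f.
pairing : ∀ {ℓ} → (Exp ℓ → ℤ) → LP ℓ → ℤ
pairing φ [] = + 0
pairing φ ((c , e) ∷ f) = c ℤ.* φ e ℤ.+ pairing φ f

dropExp : ∀ {ℓ} → Exp ℓ → LP ℓ → LP ℓ
dropExp e [] = []
dropExp e ((c , e′) ∷ f) = if does (≡-dec ℤ._≟_ e′ e) then dropExp e f else (c , e′) ∷ dropExp e f

length-dropExp : ∀ {ℓ} (e : Exp ℓ) f → length (dropExp e f) ≤ length f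
length-dropExp e [] = z≤n
length-dropExp e ((c , e′) ∷ f) with does (≡-dec ℤ._≟_ e′ e)
... | true = ℕP.m≤n⇒m≤1+n (length-dropExp e f)
... | false = s≤s (length-dropExp e f)

length-dropExp-head : ∀ {ℓ} c (e : Exp ℓ) f → length (dropExp e ((c , e) ∷ f)) ≤ length f
length-dropExp-head c e f with ≡-dec ℤ._≟_ e e
... | yes _ = length-dropExp e f
... | no e≢e = ⊥-elim (e≢e refl)

coeff-dropExp-same : ∀ {ℓ} (e : Exp ℓ) f → coeff (dropExp e f) e ≡ + 0
coeff-dropExp-same e [] = refl
coeff-dropExp-same e ((c , e′) ∷ f) with ≡-dec ℤ._≟_ e′ e
... | yes _ = coeff-dropExp-same e f
... | no e′≢e = trans (cong (λ b → (if b then c else + 0) ℤ.+ coeff (dropExp e f) e) (dec-false (≡-dec ℤ._≟_ e′ e) e′≢e))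
                      (trans (ℤP.+-identityˡ _) (coeff-dropExp-same e f))

coeff-dropExp-other : ∀ {ℓ} (e : Exp ℓ) f {e″} → e″ ≢ e → coeff (dropExp e f) e″ ≡ coeff f e″
coeff-dropExp-other e [] _ = refl
coeff-dropExp-other e ((c , e′) ∷ f) {e″} e″≢e with ≡-dec ℤ._≟_ e′ e
... | yes refl = trans (coeff-dropExp-other e f e″≢e)
                       (sym (trans (cong (λ b → (if b then c else + 0) ℤ.+ coeff f e″) (dec-false (≡-dec ℤ._≟_ e e″) (λ eq → e″≢e (sym eq))))
                                   (ℤP.+-identityˡ _)))
... | no _ = cong (λ x → (if does (≡-dec ℤ._≟_ e′ e″) then c else + 0) ℤ.+ x) (coeff-dropExp-other e f e″≢e)

dropExp-cong : ∀ {ℓ} (e : Exp ℓ) {f g} → f ≋ g → dropExp e f ≋ dropExp e g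
dropExp-cong e {f} {g} ⟨ p ⟩ = ⟨ atExp ⟩
  where
  atExp : ∀ e″ → coeff (dropExp e f) e″ ≡ coeff (dropExp e g) e″
  atExp e″ with ≡-dec ℤ._≟_ e″ e
  ... | yes refl = trans (coeff-dropExp-same e f) (sym (coeff-dropExp-same e g))
  ... | no e″≢e = trans (coeff-dropExp-other e f e″≢e) (trans (p e″) (sym (coeff-dropExp-other e g e″≢e)))

pairing-split : ∀ {ℓ} (φ : Exp ℓ → ℤ) e f → pairing φ f ≡ coeff f e ℤ.* φ e ℤ.+ pairing φ (dropExp e f)
pairing-split φ e [] = refl
pairing-split φ e ((c , e′) ∷ f) with ≡-dec ℤ._≟_ e′ e
... | yes refl = trans (cong (λ r → c ℤ.* φ e ℤ.+ r) (pairing-split φ e f)) (collect c (coeff f e) (φ e) _)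
  where
  collect : ∀ (c k x r : ℤ) → c ℤ.* x ℤ.+ (k ℤ.* x ℤ.+ r) ≡ (c ℤ.+ k) ℤ.* x ℤ.+ r
  collect = solve-∀
... | no _ = trans (cong (λ r → c ℤ.* φ e′ ℤ.+ r) (pairing-split φ e f)) (keep (c ℤ.* φ e′) (coeff f e) (φ e) _)
  where
  keep : ∀ (a k x r : ℤ) → a ℤ.+ (k ℤ.* x ℤ.+ r) ≡ (+ 0 ℤ.+ k) ℤ.* x ℤ.+ (a ℤ.+ r)
  keep = solve-∀

pairing-via-dropExp : ∀ {ℓ} (φ : Exp ℓ → ℤ) e {f g} → f ≋ g →
                      pairing φ (dropExp e f) ≡ pairing φ (dropExp e g) → pairing φ f ≡ pairing φ g
pairing-via-dropExp φ e {f} {g} ⟨ p ⟩ rest =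
  trans (pairing-split φ e f) (trans (cong₂ (λ k r → k ℤ.* φ e ℤ.+ r) (p e) rest) (sym (pairing-split φ e g)))

-- The pairing depends only on the coefficients; by induction on the total
-- length n, deleting the exponent of some head term from both sides.
pairing-cong : ∀ {ℓ} (φ : Exp ℓ → ℤ) n f g → length f ℕ.+ length g ≤ n → f ≋ g → pairing φ f ≡ pairing φ g
pairing-cong φ n [] [] _ _ = refl
pairing-cong φ zero (_ ∷ _) _ () _
pairing-cong φ zero [] (_ ∷ _) () _
pairing-cong φ (suc n) f@((c , e) ∷ f′) g (s≤s bound) f≋g =
  pairing-via-dropExp φ e f≋g (pairing-cong φ n (dropExp e f) (dropExp e g)
    (ℕP.≤-trans (ℕP.+-mono-≤ (length-dropExp-head c e f′) (length-dropExp e g)) bound) (dropExp-cong e f≋g))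
pairing-cong φ (suc n) [] g@((c , e) ∷ g′) (s≤s bound) f≋g =
  pairing-via-dropExp φ e f≋g (pairing-cong φ n [] (dropExp e g)
    (ℕP.≤-trans (length-dropExp-head c e g′) bound) (dropExp-cong e f≋g))

coeff-concatMap : ∀ {ℓ} (T : ℤ × Exp ℓ → LP ℓ) → (∀ c e′ e → coeff (T (c , e′)) e ≡ c ℤ.* coeff (T (+ 1 , e′)) e) →
                  ∀ f e → coeff (concatMap T f) e ≡ pairing (λ e′ → coeff (T (+ 1 , e′)) e) f
coeff-concatMap T linear [] e = refl
coeff-concatMap T linear ((c , e′) ∷ f) e =
  trans (coeff-++ (T (c , e′)) (concatMap T f) e) (cong₂ ℤ._+_ (linear c e′ e) (coeff-concatMap T linear f e))

concatMap-resp-≋ : ∀ {ℓ} (T : ℤ × Exp ℓ → LP ℓ) → (∀ c e′ e → coeff (T (c , e′)) e ≡ c ℤ.* coeff (T (+ 1 , e′)) e) →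
                   ∀ {f g} → f ≋ g → concatMap T f ≋ concatMap T g
concatMap-resp-≋ T linear {f} {g} f≋g = ⟨ (λ e →
  trans (coeff-concatMap T linear f e)
  (trans (pairing-cong _ (length f ℕ.+ length g) f g ℕP.≤-refl f≋g)
         (sym (coeff-concatMap T linear g e)))) ⟩

scale-map : ∀ {ℓ} {A : Set} c d (F : A → Exp ℓ) xs →
            scale c (List.map (λ k → (d , F k)) xs) ≡ List.map (λ k → (c ℤ.* d , F k)) xs
scale-map c d F xs = sym (ListP.map-∘ xs)

πmono-scale : ∀ {n} (i : Fin n) c β → πmono i (c , β) ≡ scale c (πmono i (+ 1 , β))
πmono-scale i c β with Vec.lookup β (Fin.inject₁ i) | Vec.lookup β (Fin.suc i)
... | a | b with a ℤ.- b
... | + m = sym (trans (scale-map c (+ 1) (λ k → setPair i β (a ℤ.- + k) (b ℤ.+ + k)) (List.upTo (suc m)))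
                  (cong (λ z → List.map (λ k → (z , setPair i β (a ℤ.- + k) (b ℤ.+ + k))) (List.upTo (suc m)))
                        (ℤP.*-identityʳ c)))
... | ℤ.-[1+ zero ] = refl
... | ℤ.-[1+ suc m ] = sym (trans (scale-map c (ℤ.- + 1) (λ k → setPair i β (a ℤ.+ + k) (b ℤ.- + k)) (List.map suc (List.upTo (suc m))))
                  (cong (λ z → List.map (λ k → (z , setPair i β (a ℤ.+ + k) (b ℤ.- + k))) (List.map suc (List.upTo (suc m))))
                        (trans (sym (ℤP.neg-distribʳ-* c (+ 1))) (cong ℤ.-_ (ℤP.*-identityʳ c)))))

π-cong : ∀ {n} (i : Fin n) {f g} → f ≋ g → π i f ≋ π i g
π-cong i = concatMap-resp-≋ (πmono i) (λ c β e → trans (cong (λ h → coeff h e) (πmono-scale i c β)) (coeff-scale c (πmono i (+ 1 , β)) e))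

πw-cong : ∀ {n} (w : Word n) {f g} → f ≋ g → πw w f ≋ πw w g
πw-cong [] f≋g = f≋g
πw-cong (i ∷ w) f≋g = π-cong i (πw-cong w f≋g)

πw-++ : ∀ {n} (w : Word n) f g → πw w (f ++ g) ≡ πw w f ++ πw w g
πw-++ [] f g = refl
πw-++ (i ∷ w) f g = trans (cong (π i) (πw-++ w f g)) (ListP.concatMap-++ (πmono i) (πw w f) (πw w g))

πw-[] : ∀ {n} (w : Word n) → πw w [] ≡ []
πw-[] [] = refl
πw-[] (i ∷ w) = cong (π i) (πw-[] w)

-- Only the linearity
-- fields of IsPoly are needed, not its values on key polynomials.
module PolyThenDemazure {n} (P : LP (suc n) → LP (suc n)) (isPoly : IsPoly P) (w : Word n) where
  open IsPoly isPoly

  D : LP (suc n) → LP (suc n)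
  D f = πw w (P f)

  D-cong : ∀ {f g} → f ≋ g → D f ≋ D g
  D-cong ⟨ p ⟩ = πw-cong w ⟨ resp p ⟩

  D-++ : ∀ f g → D (f ++ g) ≋ D f ++ D g
  D-++ f g = ≋-trans (πw-cong w ⟨ additive f g ⟩) (≡⇒≋ (πw-++ w (P f) (P g)))

  -- poly is homogeneous, so poly(0) = 0·poly(0) = 0
  P-[] : P [] ≋ []
  P-[] = ⟨ (λ e → trans (homogeneous (+ 0) [] e) (coeff-scale (+ 0) (P []) e)) ⟩

  D-qshift : ∀ (F : Series (suc n)) m → D (qshift F m) ≋ qshift (λ k → D (F k)) m
  D-qshift F zero = ≋-trans (πw-cong w P-[]) (≡⇒≋ (πw-[] w))
  D-qshift F (suc m) = ≋-refl

proposition5p2 : ∀ {n} (P : LP (suc n) → LP (suc n)) → IsPoly P →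
                 (Ψ : RootSet (suc n)) → IsRootIdeal Ψ →
                 (γ : Exp (suc n)) (w : Word n) (i j : Fin (suc n)) →
                 Ψ i j ≡ true → IsRootIdeal (remove Ψ i j) →
                 ∀ (m : ℕ) → H P Ψ γ w m ≈ (H P (remove Ψ i j) γ w +ˢ qshift (H P Ψ ((γ +ᵉ ε i) -ᵉ ε j) w)) m
proposition5p2 P isPoly Ψ _ γ w i j Ψij _ m = coeffwise (begin
  D (prodΨ Ψ m *ᴾ mono γ)
    ≈⟨ D-cong (recurrence-*ᴾ-mono (ε i -ᵉ ε j) (prodΨ-recurrence Ψ i j Ψij) γ γ′ (sub-add-rotate (ε i) (ε j) γ) m) ⟩
  D ((prodΨ Ψ∖α m *ᴾ mono γ) ++ qshift (λ k → prodΨ Ψ k *ᴾ mono γ′) m)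
    ≈⟨ D-++ (prodΨ Ψ∖α m *ᴾ mono γ) (qshift (λ k → prodΨ Ψ k *ᴾ mono γ′) m) ⟩
  D (prodΨ Ψ∖α m *ᴾ mono γ) ++ D (qshift (λ k → prodΨ Ψ k *ᴾ mono γ′) m)
    ≈⟨ ++-cong ≋-refl (D-qshift (λ k → prodΨ Ψ k *ᴾ mono γ′) m) ⟩
  H P Ψ∖α γ w m ++ qshift (H P Ψ γ′ w) m ∎)
  where
  open PolyThenDemazure P isPoly w
  open ≋-Reasoning
  Ψ∖α : RootSet _
  Ψ∖α = remove Ψ i j
  γ′ : Exp _
  γ′ = (γ +ᵉ ε i) -ᵉ ε j
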